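{- Let $\mathbb{K}$ be a field and let $\mathcal{C}_1,\mathcal{C}_2\subseteq \mathbb{K}^{m\times n}$ be equivalent rank metric codes. Then the translation structures $\mathscr{T}(\mathcal{C}_1)$ and $\mathscr{T}(\mathcal{C}_2)$ are isomorphic (as incidence structures). In particular, their kernels $K_{\mathcal{C}_1}$ and $K_{\mathcal{C}_2}$ are isomorphic.
   Context: A rank metric code is any subset $\mathcal{C}\subseteq\mathbb{K}^{m\times n}$. Two codes $\mathcal{C}_1,\mathcal{C}_2\subseteq \mathbb{K}^{m\times n}$ are equivalent if there exist $A\in \mathrm{GL}(m,\mathbb{K})$, $B\in\mathrm{GL}(n,\mathbb{K})$, $C\in\mathbb{K}^{m\times n}$ and $\gamma\in\mathrm{Aut}(\mathbb{K})$ with $\mathcal{C}_2=\{AX^\gamma B+C: X\in\mathcal{C}_1\}$, where $X^\gamma$ applies $\gamma$ entrywise. Vectors are row vectors. For $\mathcal{C}\subseteq\mathbb{K}^{m\times n}$ put $S(\infty)=\{(\mathbf{0},\mathbf{y}):\mathbf{y}\in\mathbb{K}^n\}$ and $S(M)=\{(\mathbf{x},\mathbf{x}M):\mathbf{x}\in\mathbb{K}^m\}$ for $M\in\mathcal{C}$. The translation structure $\mathscr{T}(\mathcal{C})$ is the incidence structure with point set $\mathbb{K}^{m+n}=\mathbb{K}^m\times\mathbb{K}^n$ and lines $S(M)+(\mathbf{0},\mathbf{b})$ ($M\in\mathcal{C},\mathbf{b}\in\mathbb{K}^n$) and $S(\infty)+(\mathbf{a},\mathbf{0})$ ($\mathbf{a}\in\mathbb{K}^m$),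 incidence being membership. Its kernel is the set of all endomorphisms $\mu$ of the additive group $(\mathbb{K}^{m+n},+)$ with $S(M)^\mu\subseteq S(M)$ for every $M\in\mathcal{C}\cup\{\infty\}$ (a ring under pointwise addition and composition). -}

module Defs where

open import Level using (Level; _⊔_) renaming (suc to lsuc)
open import Algebra.Bundles using (CommutativeRing)
open import Data.Nat using (ℕ; zero; suc)
open import Data.Fin using (Fin; zero; suc; _≟_)
open import Data.Product using (Σ; ∃; _×_; _,_; proj₁; proj₂)
open import Data.Sum using (_⊎_; inj₁; inj₂)
open import Function.Bundles using (_⇔_)
open import Relation.Nullary using (¬_; yes; no)

record Field (c ℓ : Level) : Set (lsuc (c ⊔ ℓ)) where
  field
    commutativeRing : CommutativeRing c ℓ
  open CommutativeRing commutativeRing public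
  field
    0≉1     : ¬ (0# ≈ 1#)
    inverse : ∀ x → ¬ (x ≈ 0#) → ∃ λ y → x * y ≈ 1#

record IncidenceStructure (a e b i : Level) : Set (lsuc (a ⊔ e ⊔ b ⊔ i)) where
  field
    Point : Set a
    _≈ₚ_  : Point → Point → Set e
    Line  : Set b
    _I_   : Point → Line → Set i

  _≈ₗ_ : Line → Line → Set (a ⊔ i)
  L ≈ₗ L′ = ∀ p → (p I L) ⇔ (p I L′)

record _≅ᴵ_ {a e b i a′ e′ b′ i′}
            (S : IncidenceStructure a e b i)
            (T : IncidenceStructure a′ e′ b′ i′)
            : Set (a ⊔ e ⊔ b ⊔ i ⊔ a′ ⊔ e′ ⊔ b′ ⊔ i′) where
  private
    module S = IncidenceStructure S
    module T = IncidenceStructure T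
  field
    φ      : S.Point → T.Point
    φ⁻     : T.Point → S.Point
    φ-cong  : ∀ {p q} → p S.≈ₚ q → φ p T.≈ₚ φ q
    φ⁻-cong : ∀ {p q} → p T.≈ₚ q → φ⁻ p S.≈ₚ φ⁻ q
    φ⁻∘φ   : ∀ p → φ⁻ (φ p) S.≈ₚ p
    φ∘φ⁻   : ∀ q → φ (φ⁻ q) T.≈ₚ q
    α      : S.Line → T.Line
    α⁻     : T.Line → S.Line
    α-cong  : ∀ {L L′} → L S.≈ₗ L′ → α L T.≈ₗ α L′
    α⁻-cong : ∀ {L L′} → L T.≈ₗ L′ → α⁻ L S.≈ₗ α⁻ L′
    α⁻∘α   : ∀ L → α⁻ (α L) S.≈ₗ L
    α∘α⁻   : ∀ L → α (α⁻ L) T.≈ₗ L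
    incidence : ∀ p L → (p S.I L) ⇔ (φ p T.I α L)

module _ {c ℓ : Level} (F : Field c ℓ) where
  open Field F using (Carrier; _≈_; _+_; _*_; 0#; 1#)

  Vec : ℕ → Set c
  Vec k = Fin k → Carrier

  Mat : ℕ → ℕ → Set c
  Mat m n = Fin m → Fin n → Carrier

  ∑ : ∀ {k} → (Fin k → Carrier) → Carrier
  ∑ {zero}  f = 0#
  ∑ {suc k} f = f zero + ∑ (λ i → f (suc i))

  _≈ᵥ_ : ∀ {k} → Vec k → Vec k → Set ℓ
  x ≈ᵥ y = ∀ i → x i ≈ y i

  _≈ₘ_ : ∀ {m n} → Mat m n → Mat m n → Set ℓ
  A ≈ₘ B = ∀ i j → A i j ≈ B i j

  _+ᵥ_ : ∀ {k} → Vec k → Vec k → Vec k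
  (x +ᵥ y) i = x i + y i

  0ᵥ : ∀ {k} → Vec k
  0ᵥ i = 0#

  _+ₘ_ : ∀ {m n} → Mat m n → Mat m n → Mat m n
  (A +ₘ B) i j = A i j + B i j

  _·_ : ∀ {m n} → Vec m → Mat m n → Vec n
  (x · M) j = ∑ λ i → x i * M i j

  _⊗_ : ∀ {m k n} → Mat m k → Mat k n → Mat m n
  (A ⊗ B) i l = ∑ λ j → A i j * B j l

  Id : ∀ {k} → Mat k k
  Id i j with i ≟ j
  ... | yes _ = 1#
  ... | no  _ = 0#

  Invertible : ∀ {k} → Mat k k → Set (c ⊔ ℓ)
  Invertible A = ∃ λ A′ → ((A ⊗ A′) ≈ₘ Id) × ((A′ ⊗ A) ≈ₘ Id)

  record Aut : Set (c ⊔ ℓ) where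
    field
      γ       : Carrier → Carrier
      γ-cong  : ∀ {x y} → x ≈ y → γ x ≈ γ y
      γ-+     : ∀ x y → γ (x + y) ≈ γ x + γ y
      γ-*     : ∀ x y → γ (x * y) ≈ γ x * γ y
      γ-1     : γ 1# ≈ 1#
      γ-inj   : ∀ {x y} → γ x ≈ γ y → x ≈ y
      γ-surj  : ∀ y → ∃ λ x → γ x ≈ y

  _^_ : ∀ {m n} → Mat m n → Aut → Mat m n
  (X ^ g) i j = Aut.γ g (X i j)

  -- a rank metric code: any subset of K^{m×n}
  Code : (p : Level) → ℕ → ℕ → Set (c ⊔ lsuc p)
  Code p m n = Mat m n → Set p

  Equivalent : ∀ {p m n} → Code p m n → Code p m n → Set (c ⊔ ℓ ⊔ p)
  Equivalent {m = m} {n} C₁ C₂ =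
    Σ (Mat m m) λ A → Σ (Mat n n) λ B → Σ (Mat m n) λ C → Σ Aut λ g →
      Invertible A × Invertible B ×
      (∀ Y → C₂ Y ⇔ (∃ λ X → C₁ X × (Y ≈ₘ (((A ⊗ (X ^ g)) ⊗ B) +ₘ C))))

  -- points of K^{m+n} = K^m × K^n
  Point : ℕ → ℕ → Set c
  Point m n = Vec m × Vec n

  _≈ₚ_ : ∀ {m n} → Point m n → Point m n → Set ℓ
  (x , y) ≈ₚ (x′ , y′) = (x ≈ᵥ x′) × (y ≈ᵥ y′)

  _+ₚ_ : ∀ {m n} → Point m n → Point m n → Point m n
  (x , y) +ₚ (x′ , y′) = (x +ᵥ x′) , (y +ᵥ y′)

  S∞ : ∀ {m n} → Point m n → Set (c ⊔ ℓ)
  S∞ {n = n} q = ∃ λ (y : Vec n) → q ≈ₚ (0ᵥ , y)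

  S : ∀ {m n} → Mat m n → Point m n → Set (c ⊔ ℓ)
  S {m = m} M q = ∃ λ (x : Vec m) → q ≈ₚ (x , (x · M))

  -- the lines of 𝒯(C): S(M)+(0,b) for M ∈ C, b ∈ K^n, and S(∞)+(a,0), a ∈ K^m
  TLine : ∀ {p m n} → Code p m n → Set (c ⊔ p)
  TLine {m = m} {n} C = (Σ (Σ (Mat m n) C) λ _ → Vec n) ⊎ Vec m

  _∈T_ : ∀ {p m n} {C : Code p m n} → Point m n → TLine C → Set (c ⊔ ℓ)
  q ∈T inj₁ ((M , _) , b) = ∃ λ s → S M s × (q ≈ₚ (s +ₚ (0ᵥ , b)))
  q ∈T inj₂ a             = ∃ λ s → S∞ s × (q ≈ₚ (s +ₚ (a , 0ᵥ)))

  𝒯 : ∀ {p m n} → Code p m n → IncidenceStructure c ℓ (c ⊔ p) (c ⊔ ℓ)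
  𝒯 {m = m} {n} C = record
    { Point = Point m n
    ; _≈ₚ_  = _≈ₚ_
    ; Line  = TLine C
    ; _I_   = _∈T_ {C = C}
    }

  record KerElem {p m n} (C : Code p m n) : Set (c ⊔ ℓ ⊔ p) where
    field
      μ       : Point m n → Point m n
      μ-cong  : ∀ {q r} → q ≈ₚ r → μ q ≈ₚ μ r
      μ-+     : ∀ q r → μ (q +ₚ r) ≈ₚ (μ q +ₚ μ r)
      μ-S∞    : ∀ q → S∞ q → S∞ (μ q)
      μ-S     : ∀ M → C M → ∀ q → S M q → S M (μ q)

  _≈K_ : ∀ {p m n} {C : Code p m n} → KerElem C → KerElem C → Set (c ⊔ ℓ)
  μ ≈K ν = ∀ q → KerElem.μ μ q ≈ₚ KerElem.μ ν q

  _+K_ : ∀ {m n} → (Point m n → Point m n) → (Point m n → Point m n) → Point m n → Point m n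
  (f +K g) q = f q +ₚ g q

  _∘K_ : ∀ {m n} → (Point m n → Point m n) → (Point m n → Point m n) → Point m n → Point m n
  (f ∘K g) q = g (f q)   -- q^{fg} = (q^f)^g

  record KernelIso {p m n} (C₁ C₂ : Code p m n) : Set (c ⊔ ℓ ⊔ p) where
    field
      Φ      : KerElem C₁ → KerElem C₂
      Φ⁻     : KerElem C₂ → KerElem C₁
      Φ-cong  : ∀ {μ ν} → μ ≈K ν → Φ μ ≈K Φ ν
      Φ⁻-cong : ∀ {μ ν} → μ ≈K ν → Φ⁻ μ ≈K Φ⁻ ν
      Φ⁻∘Φ   : ∀ μ → Φ⁻ (Φ μ) ≈K μ
      Φ∘Φ⁻   : ∀ ν → Φ (Φ⁻ ν) ≈K ν
      Φ-+    : ∀ μ ν ρ → (∀ q → KerElem.μ ρ q ≈ₚ (KerElem.μ μ +K KerElem.μ ν) q)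
                 → ∀ q → KerElem.μ (Φ ρ) q ≈ₚ (KerElem.μ (Φ μ) +K KerElem.μ (Φ ν)) q
      Φ-*    : ∀ μ ν ρ → (∀ q → KerElem.μ ρ q ≈ₚ (KerElem.μ μ ∘K KerElem.μ ν) q)
                 → ∀ q → KerElem.μ (Φ ρ) q ≈ₚ (KerElem.μ (Φ μ) ∘K KerElem.μ (Φ ν)) q
      Φ-1    : ∀ ρ → (∀ q → KerElem.μ ρ q ≈ₚ q) → ∀ q → KerElem.μ (Φ ρ) q ≈ₚ q

-- An equivalence X ↦ A X^γ B + C is induced by the additive bijection
-- φ (x , y) = (x^γ A⁻¹ , y^γ B + x^γ A⁻¹ C) of K^{m+n}, the composite of the semilinear maps
-- x ↦ x^γ A⁻¹, y ↦ y^γ B with the shear (x , y) ↦ (x , y + x C).  Since x^γ A⁻¹ (A X^γ B + C)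
-- = (x X)^γ B + x^γ A⁻¹ C, φ maps S(X) + (0 , b) onto S(A X^γ B + C) + (0 , b^γ B) and
-- S(∞) + (a , 0) onto S(∞) + (a^γ A⁻¹ , 0), an isomorphism of the translation structures.
-- As φ is additive and carries the components S(X), S(∞) of one spread onto those of the
-- other, conjugation μ ↦ φ⁻¹ μ φ is a ring isomorphism between the kernels.

module Submission where

open import Defs
open import Level using (Level; _⊔_)
open import Data.Nat using (ℕ; zero; suc)
open import Data.Fin using (Fin; zero; suc; _≟_)
open import Data.Product using (∃; _×_; _,_; proj₁; proj₂)
open import Data.Product.Relation.Binary.Pointwise.NonDependent using (_×ₛ_)
open import Data.Product.Function.NonDependent.Setoid using (_×-inverse_)
open import Data.Sum using (inj₁; inj₂)
open import Relation.Nullary using (yes; no)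
open import Relation.Binary.Bundles using (Setoid)
import Relation.Binary.Reasoning.Setoid as SetoidReasoning
open import Algebra.Bundles using (AbelianGroup)
import Algebra.Construct.Pointwise as Pointwise
import Algebra.Construct.DirectProduct as DirectProduct
import Algebra.Properties.AbelianGroup as AbelianGroupProperties
import Algebra.Properties.CommutativeSemigroup as CommutativeSemigroupProperties
open import Function.Bundles using (Inverse; Injection; Equivalence; _⇔_; mk⇔)
open import Function.Properties.Inverse using (Inverse⇒Injection)
open import Function.Related.Propositional using (module EquationalReasoning; equivalence)
import Function.Consequences.Setoid as FunctionConsequences
import Function.Construct.Composition as Composition
import Function.Properties.Equivalence as ⇔

mkInverse : ∀ {a ℓ₁ b ℓ₂} {S : Setoid a ℓ₁} {T : Setoid b ℓ₂} →
            let module S = Setoid S; module T = Setoid T in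
            (to : S.Carrier → T.Carrier) (from : T.Carrier → S.Carrier) →
            (∀ {x y} → x S.≈ y → to x T.≈ to y) → (∀ {x y} → x T.≈ y → from x S.≈ from y) →
            (∀ y → to (from y) T.≈ y) → (∀ x → from (to x) S.≈ x) → Inverse S T
mkInverse {S = S} {T} to from to-cong from-cong to∘from from∘to = record
  { to        = to
  ; from      = from
  ; to-cong   = to-cong
  ; from-cong = from-cong
  ; inverse   = strictlyInverseˡ⇒inverseˡ to-cong to∘from , strictlyInverseʳ⇒inverseʳ from-cong from∘to
  }
  where open FunctionConsequences S T

to-≈⇔ : ∀ {a ℓ₁ b ℓ₂} {S : Setoid a ℓ₁} {T : Setoid b ℓ₂} (f : Inverse S T) →
        let module S = Setoid S; module T = Setoid T in
        ∀ {x y} → x S.≈ y ⇔ Inverse.to f x T.≈ Inverse.to f y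
to-≈⇔ f = mk⇔ (Inverse.to-cong f) (Injection.injective (Inverse⇒Injection f))

module LinearAlgebra {c ℓ : Level} (F : Field c ℓ) where
  open Field F hiding (zero)
  open SetoidReasoning setoid

  ∑-cong : ∀ {k} {f g : Fin k → Carrier} → (∀ i → f i ≈ g i) → ∑ F f ≈ ∑ F g
  ∑-cong {zero}  _   = refl
  ∑-cong {suc k} f≈g = +-cong (f≈g zero) (∑-cong (λ i → f≈g (suc i)))

  ∑-zero : ∀ {k} (f : Fin k → Carrier) → (∀ i → f i ≈ 0#) → ∑ F f ≈ 0#
  ∑-zero {zero}  f f≈0 = refl
  ∑-zero {suc k} f f≈0 = trans (+-cong (f≈0 zero) (∑-zero _ (λ i → f≈0 (suc i)))) (+-identityˡ 0#)

  ∑-distrib-+ : ∀ {k} (f g : Fin k → Carrier) → ∑ F (λ i → f i + g i) ≈ ∑ F f + ∑ F g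
  ∑-distrib-+ {zero}  f g = sym (+-identityˡ 0#)
  ∑-distrib-+ {suc k} f g =
    trans (+-congˡ (∑-distrib-+ (λ i → f (suc i)) (λ i → g (suc i)))) (interchange _ _ _ _)
    where open CommutativeSemigroupProperties +-commutativeSemigroup using (interchange)

  *-distribˡ-∑ : ∀ {k} a (f : Fin k → Carrier) → a * ∑ F f ≈ ∑ F (λ i → a * f i)
  *-distribˡ-∑ {zero}  a f = zeroʳ a
  *-distribˡ-∑ {suc k} a f = trans (distribˡ a _ _) (+-congˡ (*-distribˡ-∑ a (λ i → f (suc i))))

  *-distribʳ-∑ : ∀ {k} a (f : Fin k → Carrier) → ∑ F f * a ≈ ∑ F (λ i → f i * a)
  *-distribʳ-∑ {zero}  a f = zeroˡ a
  *-distribʳ-∑ {suc k} a f = trans (distribʳ a _ _) (+-congˡ (*-distribʳ-∑ a (λ i → f (suc i))))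

  ∑-comm : ∀ {k l} (f : Fin k → Fin l → Carrier) →
           ∑ F (λ i → ∑ F (λ j → f i j)) ≈ ∑ F (λ j → ∑ F (λ i → f i j))
  ∑-comm {zero} {l} f = sym (∑-zero {l} (λ j → 0#) (λ _ → refl))
  ∑-comm {suc k} f = trans (+-congˡ (∑-comm (λ i → f (suc i)))) (sym (∑-distrib-+ (f zero) _))

  Id-suc : ∀ {k} (i j : Fin k) → Id F (suc i) (suc j) ≈ Id F i j
  Id-suc i j with i ≟ j
  ... | yes _ = refl
  ... | no  _ = refl

  ∑-*-Id : ∀ {k} (x : Fin k → Carrier) j → ∑ F (λ i → x i * Id F i j) ≈ x j
  ∑-*-Id x zero = begin
    x zero * 1# + ∑ F (λ i → x (suc i) * 0#)
      ≈⟨ +-cong (*-identityʳ _) (∑-zero (λ i → x (suc i) * 0#) (λ i → zeroʳ _)) ⟩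
    x zero + 0#                               ≈⟨ +-identityʳ _ ⟩
    x zero                                    ∎
  ∑-*-Id x (suc j) = begin
    x zero * 0# + ∑ F (λ i → x (suc i) * Id F (suc i) (suc j))
      ≈⟨ +-cong (zeroʳ _) (∑-cong (λ i → *-congˡ (Id-suc i j))) ⟩
    0# + ∑ F (λ i → x (suc i) * Id F i j)  ≈⟨ +-identityˡ _ ⟩
    ∑ F (λ i → x (suc i) * Id F i j)       ≈⟨ ∑-*-Id (λ i → x (suc i)) j ⟩
    x (suc j)                              ∎

  vectorGroup : ℕ → AbelianGroup c ℓ
  vectorGroup k = Pointwise.abelianGroup (Fin k) +-abelianGroup

  pointGroup : ℕ → ℕ → AbelianGroup c ℓ
  pointGroup m n = DirectProduct.abelianGroup (vectorGroup m) (vectorGroup n)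

  module V {k : ℕ} = AbelianGroup (vectorGroup k)
  module P {m n : ℕ} = AbelianGroup (pointGroup m n)

  pointSetoid : ℕ → ℕ → Setoid c ℓ
  pointSetoid m n = V.setoid {m} ×ₛ V.setoid {n}

  infix  4 _≋_
  infixl 6 _⊕_
  infixl 7 _∙_

  _≋_ : ∀ {k} → Vec F k → Vec F k → Set ℓ
  _≋_ = _≈ᵥ_ F

  _⊕_ : ∀ {k} → Vec F k → Vec F k → Vec F k
  _⊕_ = _+ᵥ_ F

  _∙_ : ∀ {m n} → Vec F m → Mat F m n → Vec F n
  _∙_ = _·_ F

  infix  4 _≈ᴹ_
  infixl 6 _+ᴹ_
  infixl 7 _⊗ᴹ_

  _≈ᴹ_ : ∀ {m n} → Mat F m n → Mat F m n → Set ℓ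
  _≈ᴹ_ = _≈ₘ_ F

  _+ᴹ_ : ∀ {m n} → Mat F m n → Mat F m n → Mat F m n
  _+ᴹ_ = _+ₘ_ F

  _⊗ᴹ_ : ∀ {m k n} → Mat F m k → Mat F k n → Mat F m n
  _⊗ᴹ_ = _⊗_ F

  ≈ᴹ-refl : ∀ {m n} {M : Mat F m n} → M ≈ᴹ M
  ≈ᴹ-refl _ _ = refl

  infix  4 _≈ᴾ_
  infixl 6 _⊕ᴾ_

  _≈ᴾ_ : ∀ {m n} → Point F m n → Point F m n → Set ℓ
  _≈ᴾ_ = _≈ₚ_ F

  _⊕ᴾ_ : ∀ {m n} → Point F m n → Point F m n → Point F m n
  _⊕ᴾ_ = _+ₚ_ F

  ≋-respʳ⇔ : ∀ {k} {x y z : Vec F k} → y ≋ z → x ≋ y ⇔ x ≋ z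
  ≋-respʳ⇔ y≋z = mk⇔ (λ x≋y → V.trans x≋y y≋z) (λ x≋z → V.trans x≋z (V.sym y≋z))

  ∙-cong : ∀ {m n} {x y : Vec F m} {M N : Mat F m n} → x ≋ y → M ≈ᴹ N → x ∙ M ≋ y ∙ N
  ∙-cong x≋y M≈N j = ∑-cong (λ i → *-cong (x≋y i) (M≈N i j))

  ∙-congʳ : ∀ {m n} (M : Mat F m n) {x y : Vec F m} → x ≋ y → x ∙ M ≋ y ∙ M
  ∙-congʳ M x≋y j = ∑-cong (λ i → *-congʳ (x≋y i))

  ∙-distribʳ : ∀ {m n} (M : Mat F m n) (x y : Vec F m) → (x ⊕ y) ∙ M ≋ x ∙ M ⊕ y ∙ M
  ∙-distribʳ M x y j =
    trans (∑-cong (λ i → distribʳ (M i j) (x i) (y i))) (∑-distrib-+ (λ i → x i * M i j) _)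

  ∙-distribˡ : ∀ {m n} (x : Vec F m) (M N : Mat F m n) → x ∙ (M +ᴹ N) ≋ x ∙ M ⊕ x ∙ N
  ∙-distribˡ x M N j =
    trans (∑-cong (λ i → distribˡ (x i) (M i j) (N i j))) (∑-distrib-+ (λ i → x i * M i j) _)

  ∙-assoc : ∀ {m k n} (x : Vec F m) (M : Mat F m k) (N : Mat F k n) → x ∙ M ∙ N ≋ x ∙ (M ⊗ᴹ N)
  ∙-assoc x M N l = begin
    ∑ F (λ j → ∑ F (λ i → x i * M i j) * N j l)
      ≈⟨ ∑-cong (λ j → *-distribʳ-∑ (N j l) (λ i → x i * M i j)) ⟩
    ∑ F (λ j → ∑ F (λ i → x i * M i j * N j l))
      ≈⟨ ∑-cong (λ j → ∑-cong (λ i → *-assoc (x i) (M i j) (N j l))) ⟩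
    ∑ F (λ j → ∑ F (λ i → x i * (M i j * N j l)))
      ≈⟨ ∑-comm (λ j i → x i * (M i j * N j l)) ⟩
    ∑ F (λ i → ∑ F (λ j → x i * (M i j * N j l)))
      ≈⟨ ∑-cong (λ i → *-distribˡ-∑ (x i) (λ j → M i j * N j l)) ⟨
    ∑ F (λ i → x i * ∑ F (λ j → M i j * N j l))
      ∎

  ∙-identityʳ : ∀ {k} (x : Vec F k) → x ∙ Id F ≋ x
  ∙-identityʳ = ∑-*-Id

  ∙-zeroˡ : ∀ {m n} (M : Mat F m n) → 0ᵥ F ∙ M ≋ 0ᵥ F
  ∙-zeroˡ M j = ∑-zero _ (λ i → zeroˡ (M i j))

  ∙-cancel : ∀ {k n} (M : Mat F k n) (M′ : Mat F n k) → M ⊗ᴹ M′ ≈ᴹ Id F → ∀ x → x ∙ M ∙ M′ ≋ x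
  ∙-cancel M M′ MM′≈Id x = V.trans (∙-assoc x M M′) (V.trans (∙-cong V.refl MM′≈Id) (∙-identityʳ x))

  inverse-invertible : ∀ {k} {M : Mat F k k} (M-inv : Invertible F M) → Invertible F (proj₁ M-inv)
  inverse-invertible {M = M} (M′ , MM′≈Id , M′M≈Id) = M , M′M≈Id , MM′≈Id

  module VP {k : ℕ} = AbelianGroupProperties (vectorGroup k)

  ⊕-cancelʳ⇔ : ∀ {k} {x y : Vec F k} z → x ≋ y ⇔ x ⊕ z ≋ y ⊕ z
  ⊕-cancelʳ⇔ z = mk⇔ V.∙-congʳ (VP.∙-cancelʳ z _ _)

  shear : ∀ {m n} → Mat F m n → Inverse (pointSetoid m n) (pointSetoid m n)
  shear C = mkInverse (λ (u , v) → u , v ⊕ u ∙ C) (λ (u , v) → u , v V.- u ∙ C)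
    (λ (u≋u′ , v≋v′) → u≋u′ , V.∙-cong v≋v′ (∙-congʳ C u≋u′))
    (λ (u≋u′ , v≋v′) → u≋u′ , VP.//-cong₂ v≋v′ (∙-congʳ C u≋u′))
    (λ (u , v) → V.refl , VP.//-rightDividesˡ (u ∙ C) v)
    (λ (u , v) → V.refl , VP.//-rightDividesʳ (u ∙ C) v)

  shear-+ : ∀ {m n} (C : Mat F m n) q r →
            Inverse.to (shear C) (q ⊕ᴾ r) ≈ᴾ Inverse.to (shear C) q ⊕ᴾ Inverse.to (shear C) r
  shear-+ C (u , v) (u′ , v′) =
    V.refl , V.trans (V.∙-congˡ (∙-distribʳ C u u′)) (interchange v v′ (u ∙ C) (u′ ∙ C))
    where open CommutativeSemigroupProperties V.commutativeSemigroup using (interchange)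

  module Semilinear (g : Aut F) where
    open Aut g

    γ-0 : γ 0# ≈ 0#
    γ-0 = ∙-cancelʳ (γ 0#) (γ 0#) 0# (begin
      γ 0# + γ 0#  ≈⟨ γ-+ 0# 0# ⟨
      γ (0# + 0#)  ≈⟨ γ-cong (+-identityˡ 0#) ⟩
      γ 0#         ≈⟨ +-identityˡ (γ 0#) ⟨
      0# + γ 0#    ∎)
      where open AbelianGroupProperties +-abelianGroup using (∙-cancelʳ)

    γ-∑ : ∀ {k} (f : Fin k → Carrier) → γ (∑ F f) ≈ ∑ F (λ i → γ (f i))
    γ-∑ {zero}  f = γ-0
    γ-∑ {suc k} f = trans (γ-+ _ _) (+-congˡ (γ-∑ (λ i → f (suc i))))

    γ⁻¹ : Carrier → Carrier
    γ⁻¹ y = proj₁ (γ-surj y)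

    γ∘γ⁻¹ : ∀ y → γ (γ⁻¹ y) ≈ y
    γ∘γ⁻¹ y = proj₂ (γ-surj y)

    γᵥ : ∀ {k} → Vec F k → Vec F k
    γᵥ x i = γ (x i)

    γ⁻¹ᵥ : ∀ {k} → Vec F k → Vec F k
    γ⁻¹ᵥ x i = γ⁻¹ (x i)

    γᵥ-∙ : ∀ {m n} (x : Vec F m) (M : Mat F m n) → γᵥ (x ∙ M) ≋ γᵥ x ∙ (_^_ F M g)
    γᵥ-∙ x M j = trans (γ-∑ (λ i → x i * M i j)) (∑-cong (λ i → γ-* (x i) (M i j)))

    semilinear : ∀ {k} (M : Mat F k k) → Invertible F M → Inverse (V.setoid {k}) (V.setoid {k})
    semilinear M (M′ , MM′≈Id , M′M≈Id) = mkInverse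
      (λ x → γᵥ x ∙ M) (λ y → γ⁻¹ᵥ (y ∙ M′))
      (λ x≋y → ∙-congʳ M (λ i → γ-cong (x≋y i)))
      (λ x≋y i → γ-inj (trans (γ∘γ⁻¹ _) (trans (∙-congʳ M′ x≋y i) (sym (γ∘γ⁻¹ _)))))
      (λ y → V.trans (∙-congʳ M (λ i → γ∘γ⁻¹ _)) (∙-cancel M′ M M′M≈Id y))
      (λ x i → γ-inj (trans (γ∘γ⁻¹ _) (∙-cancel M M′ MM′≈Id (γᵥ x) i)))

    semilinear-+ : ∀ {k} (M : Mat F k k) (x y : Vec F k) → γᵥ (x ⊕ y) ∙ M ≋ γᵥ x ∙ M ⊕ γᵥ y ∙ M
    semilinear-+ M x y = V.trans (∙-congʳ M (λ i → γ-+ (x i) (y i))) (∙-distribʳ M (γᵥ x) (γᵥ y))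

    semilinear-0 : ∀ {k} (M : Mat F k k) → γᵥ (0ᵥ F) ∙ M ≋ 0ᵥ F
    semilinear-0 M = V.trans (∙-congʳ M (λ _ → γ-0)) (∙-zeroˡ M)

module TranslationStructure {c ℓ : Level} (F : Field c ℓ) where
  open LinearAlgebra F

  OnGraph : ∀ {m n} → Mat F m n → Vec F n → Point F m n → Set ℓ
  OnGraph M b (u , v) = v ≋ u ∙ M ⊕ b

  OnGraph-resp : ∀ {m n} (M : Mat F m n) b {q r} → q ≈ᴾ r → OnGraph M b q → OnGraph M b r
  OnGraph-resp M b (u≋u′ , v≋v′) v≋uM+b =
    V.trans (V.sym v≋v′) (V.trans v≋uM+b (V.∙-congʳ (∙-congʳ M u≋u′)))

  S⇔OnGraph : ∀ {m n} (M : Mat F m n) q → S F M q ⇔ OnGraph M (0ᵥ F) q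
  S⇔OnGraph M (u , v) = mk⇔
    (λ (x , u≋x , v≋xM) → V.trans v≋xM (V.trans (∙-congʳ M (V.sym u≋x)) (V.sym (V.identityʳ _))))
    (λ v≋uM+0 → u , V.refl , V.trans v≋uM+0 (V.identityʳ _))

  S∞⇔ : ∀ {m n} (q : Point F m n) → S∞ F q ⇔ (proj₁ q ≋ 0ᵥ F)
  S∞⇔ (u , v) = mk⇔ (λ (y , u≋0 , _) → u≋0) (λ u≋0 → v , u≋0 , V.refl)

  S-resp : ∀ {m n} (M : Mat F m n) {q r} → q ≈ᴾ r → S F M q → S F M r
  S-resp M {q} {r} q≈r q∈S =
    Equivalence.from (S⇔OnGraph M r) (OnGraph-resp M (0ᵥ F) q≈r (Equivalence.to (S⇔OnGraph M q) q∈S))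

  S∞-resp : ∀ {m n} {q r : Point F m n} → q ≈ᴾ r → S∞ F q → S∞ F r
  S∞-resp {r = u′ , v′} (u≋u′ , _) (y , u≋0 , _) = v′ , V.trans (V.sym u≋u′) u≋0 , V.refl

  module _ {p m n} {C : Code F p m n} where
    _∈_ : Point F m n → TLine F C → Set (c ⊔ ℓ)
    _∈_ = _∈T_ F {C = C}

    ∈-graph⇔ : ∀ M (M∈C : C M) b q → q ∈ inj₁ ((M , M∈C) , b) ⇔ OnGraph M b q
    ∈-graph⇔ M M∈C b (u , v) = mk⇔
      (λ ((s , t) , (x , s≋x , t≋xM) , (u≋s+0 , v≋t+b)) → V.trans v≋t+b
        (V.∙-congʳ (V.trans t≋xM (∙-congʳ M (V.sym (V.trans u≋s+0 (V.trans (V.identityʳ s) s≋x)))))))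
      (λ v≋uM+b → (u , u ∙ M) , (u , V.refl , V.refl) , (V.sym (V.identityʳ u) , v≋uM+b))

    ∈-vertical⇔ : ∀ a q → q ∈ inj₂ a ⇔ (proj₁ q ≋ a)
    ∈-vertical⇔ a (u , v) = mk⇔
      (λ ((s , t) , (y , s≋0 , _) , (u≋s+a , _)) →
        V.trans u≋s+a (V.trans (V.∙-congʳ s≋0) (V.identityˡ a)))
      (λ u≋a → (0ᵥ F , v) , (v , V.refl , V.refl) ,
               (V.trans u≋a (V.sym (V.identityˡ a)) , V.sym (V.identityʳ v)))

    ∈-resp : ∀ L {q r} → q ≈ᴾ r → q ∈ L ⇔ r ∈ L
    ∈-resp (inj₁ ((M , M∈C) , b)) q≈r = ⇔.trans (∈-graph⇔ M M∈C b _)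
      (⇔.trans (mk⇔ (OnGraph-resp M b q≈r) (OnGraph-resp M b (P.sym q≈r))) (⇔.sym (∈-graph⇔ M M∈C b _)))
    ∈-resp (inj₂ a) (u≋u′ , _) = ⇔.trans (∈-vertical⇔ a _)
      (⇔.trans (mk⇔ (V.trans (V.sym u≋u′)) (V.trans u≋u′)) (⇔.sym (∈-vertical⇔ a _)))

module _ {a e b i a′ e′ b′ i′}
         {𝔖 : IncidenceStructure a e b i} {𝔗 : IncidenceStructure a′ e′ b′ i′} where
  private
    module 𝔖 = IncidenceStructure 𝔖
    module 𝔗 = IncidenceStructure 𝔗

  ≅ᴵ-from-incidence :
    (φ : 𝔖.Point → 𝔗.Point) (φ⁻ : 𝔗.Point → 𝔖.Point) →
    (∀ {p q} → p 𝔖.≈ₚ q → φ p 𝔗.≈ₚ φ q) → (∀ {p q} → p 𝔗.≈ₚ q → φ⁻ p 𝔖.≈ₚ φ⁻ q) →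
    (∀ p → φ⁻ (φ p) 𝔖.≈ₚ p) → (∀ q → φ (φ⁻ q) 𝔗.≈ₚ q) →
    (∀ L {p q} → p 𝔗.≈ₚ q → (p 𝔗.I L) ⇔ (q 𝔗.I L)) →
    (α : 𝔖.Line → 𝔗.Line) (α⁻ : 𝔗.Line → 𝔖.Line) →
    (∀ p L → (p 𝔖.I L) ⇔ (φ p 𝔗.I α L)) →
    (∀ p L → (p 𝔖.I α⁻ L) ⇔ (φ p 𝔗.I L)) →
    𝔖 ≅ᴵ 𝔗
  ≅ᴵ-from-incidence φ φ⁻ φ-cong φ⁻-cong φ⁻∘φ φ∘φ⁻ I-resp α α⁻ α-incidence α⁻-incidence = record
    { φ         = φ
    ; φ⁻        = φ⁻
    ; φ-cong    = φ-cong
    ; φ⁻-cong   = φ⁻-cong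
    ; φ⁻∘φ      = φ⁻∘φ
    ; φ∘φ⁻      = φ∘φ⁻
    ; α         = α
    ; α⁻        = α⁻
    ; α-cong    = λ {L} {L′} L≈L′ q → ⇔.trans (pull q L) (⇔.trans (L≈L′ (φ⁻ q)) (⇔.sym (pull q L′)))
    ; α⁻-cong   = λ {L} {L′} L≈L′ p →
        ⇔.trans (α⁻-incidence p L) (⇔.trans (L≈L′ (φ p)) (⇔.sym (α⁻-incidence p L′)))
    ; α⁻∘α      = λ L p → ⇔.trans (α⁻-incidence p (α L)) (⇔.sym (α-incidence p L))
    ; α∘α⁻      = λ L q →
        ⇔.trans (pull q (α⁻ L)) (⇔.trans (α⁻-incidence (φ⁻ q) L) (I-resp L (φ∘φ⁻ q)))
    ; incidence = α-incidence
    }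
    where
    pull : ∀ q L → (q 𝔗.I α L) ⇔ (φ⁻ q 𝔖.I L)
    pull q L = ⇔.trans (⇔.sym (I-resp (α L) (φ∘φ⁻ q))) (⇔.sym (α-incidence (φ⁻ q) L))

module _ {c ℓ p : Level} (F : Field c ℓ) {m n : ℕ} {C₁ C₂ : Code F p m n} where
  open LinearAlgebra F
  open TranslationStructure F

  kernelIso-by-conjugation :
    (φ : Inverse (pointSetoid m n) (pointSetoid m n)) →
    let open Inverse φ in
    (∀ q r → to (q ⊕ᴾ r) ≈ᴾ to q ⊕ᴾ to r) →
    (∀ q → S∞ F q ⇔ S∞ F (to q)) →
    (∀ X → C₁ X → ∃ λ Y → C₂ Y × (∀ q → S F X q ⇔ S F Y (to q))) →
    (∀ Y → C₂ Y → ∃ λ X → C₁ X × (∀ q → S F X q ⇔ S F Y (to q))) →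
    KernelIso F C₁ C₂
  kernelIso-by-conjugation φ to-+ S∞-preserved C₁→C₂ C₂→C₁ = record
    { Φ       = conjugate
    ; Φ⁻      = unconjugate
    ; Φ-cong  = λ μ≈ν q → to-cong (μ≈ν (from q))
    ; Φ⁻-cong = λ μ≈ν q → from-cong (μ≈ν (to q))
    ; Φ⁻∘Φ    = λ μ q → P.trans (strictlyInverseʳ _) (KerElem.μ-cong μ (strictlyInverseʳ q))
    ; Φ∘Φ⁻    = λ ν q → P.trans (strictlyInverseˡ _) (KerElem.μ-cong ν (strictlyInverseˡ q))
    ; Φ-+     = λ μ ν ρ ρ≈μ+ν q → P.trans (to-cong (ρ≈μ+ν (from q))) (to-+ _ _)
    ; Φ-*     = λ μ ν ρ ρ≈μν q →
        P.trans (to-cong (ρ≈μν (from q))) (to-cong (KerElem.μ-cong ν (P.sym (strictlyInverseʳ _))))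
    ; Φ-1     = λ ρ ρ≈1 q → P.trans (to-cong (ρ≈1 (from q))) (strictlyInverseˡ q)
    }
    where
    open Inverse φ

    from-+ : ∀ q r → from (q ⊕ᴾ r) ≈ᴾ from q ⊕ᴾ from r
    from-+ q r = begin
      from (q ⊕ᴾ r)                     ≈⟨ from-cong (P.∙-cong (strictlyInverseˡ q) (strictlyInverseˡ r)) ⟨
      from (to (from q) ⊕ᴾ to (from r)) ≈⟨ from-cong (to-+ (from q) (from r)) ⟨
      from (to (from q ⊕ᴾ from r))      ≈⟨ strictlyInverseʳ _ ⟩
      from q ⊕ᴾ from r                  ∎
      where open SetoidReasoning (pointSetoid m n)

    conjugate : KerElem F C₁ → KerElem F C₂
    conjugate μ = record
      { μ      = λ q → to (K.μ (from q))
      ; μ-cong = λ q≈r → to-cong (K.μ-cong (from-cong q≈r))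
      ; μ-+    = λ q r → P.trans (to-cong (P.trans (K.μ-cong (from-+ q r)) (K.μ-+ _ _))) (to-+ _ _)
      ; μ-S∞   = λ q q∈S∞ → Equivalence.to (S∞-preserved _)
          (K.μ-S∞ _ (Equivalence.from (S∞-preserved _) (S∞-resp (P.sym (strictlyInverseˡ q)) q∈S∞)))
      ; μ-S    = λ Y Y∈C₂ q q∈SY → let (X , X∈C₁ , SX⇔SY) = C₂→C₁ Y Y∈C₂ in
          Equivalence.to (SX⇔SY _)
            (K.μ-S X X∈C₁ _ (Equivalence.from (SX⇔SY _) (S-resp Y (P.sym (strictlyInverseˡ q)) q∈SY)))
      }
      where module K = KerElem μ

    unconjugate : KerElem F C₂ → KerElem F C₁
    unconjugate ν = record
      { μ      = λ q → from (K.μ (to q))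
      ; μ-cong = λ q≈r → from-cong (K.μ-cong (to-cong q≈r))
      ; μ-+    = λ q r → P.trans (from-cong (P.trans (K.μ-cong (to-+ q r)) (K.μ-+ _ _))) (from-+ _ _)
      ; μ-S∞   = λ q q∈S∞ → Equivalence.from (S∞-preserved _)
          (S∞-resp (P.sym (strictlyInverseˡ _)) (K.μ-S∞ _ (Equivalence.to (S∞-preserved q) q∈S∞)))
      ; μ-S    = λ X X∈C₁ q q∈SX → let (Y , Y∈C₂ , SX⇔SY) = C₁→C₂ X X∈C₁ in
          Equivalence.from (SX⇔SY _)
            (S-resp Y (P.sym (strictlyInverseˡ _)) (K.μ-S Y Y∈C₂ _ (Equivalence.to (SX⇔SY q) q∈SX)))
      }
      where module K = KerElem ν

module EquivalentCodes {c ℓ : Level} (F : Field c ℓ) {m n : ℕ}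
                       (A : Mat F m m) (B : Mat F n n) (C : Mat F m n) (g : Aut F)
                       (A-inv : Invertible F A) (B-inv : Invertible F B) where
  open LinearAlgebra F
  open Semilinear g
  open TranslationStructure F

  transform : Mat F m n → Mat F m n
  transform X = A ⊗ᴹ _^_ F X g ⊗ᴹ B +ᴹ C

  A⁻¹ : Mat F m m
  A⁻¹ = proj₁ A-inv

  semilinearᴬ : Inverse (V.setoid {m}) (V.setoid {m})
  semilinearᴬ = semilinear A⁻¹ (inverse-invertible A-inv)

  semilinearᴮ : Inverse (V.setoid {n}) (V.setoid {n})
  semilinearᴮ = semilinear B B-inv

  σᴬ : Vec F m → Vec F m
  σᴬ = Inverse.to semilinearᴬ

  σᴮ : Vec F n → Vec F n
  σᴮ = Inverse.to semilinearᴮ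

  φ : Inverse (pointSetoid m n) (pointSetoid m n)
  φ = Composition.inverse (semilinearᴬ ×-inverse semilinearᴮ) (shear C)

  φ-+ : ∀ q r → Inverse.to φ (q ⊕ᴾ r) ≈ᴾ Inverse.to φ q ⊕ᴾ Inverse.to φ r
  φ-+ (u , v) (u′ , v′) =
    P.trans (Inverse.to-cong (shear C) (semilinear-+ A⁻¹ u u′ , semilinear-+ B v v′)) (shear-+ C _ _)

  σᴬ-∙-transform : ∀ X u b → σᴬ u ∙ transform X ⊕ σᴮ b ≋ σᴮ (u ∙ X ⊕ b) ⊕ σᴬ u ∙ C
  σᴬ-∙-transform X u b = begin
    w ∙ transform X ⊕ σᴮ b              ≈⟨ V.∙-congʳ (∙-distribˡ w (A ⊗ᴹ Xᵍ ⊗ᴹ B) C) ⟩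
    w ∙ (A ⊗ᴹ Xᵍ ⊗ᴹ B) ⊕ w ∙ C ⊕ σᴮ b    ≈⟨ xy∙z≈xz∙y _ _ _ ⟩
    w ∙ (A ⊗ᴹ Xᵍ ⊗ᴹ B) ⊕ σᴮ b ⊕ w ∙ C    ≈⟨ V.∙-congʳ (V.∙-congʳ linear-part) ⟩
    σᴮ (u ∙ X) ⊕ σᴮ b ⊕ w ∙ C           ≈⟨ V.∙-congʳ (semilinear-+ B (u ∙ X) b) ⟨
    σᴮ (u ∙ X ⊕ b) ⊕ w ∙ C              ∎
    where
    open SetoidReasoning V.setoid
    open CommutativeSemigroupProperties V.commutativeSemigroup using (xy∙z≈xz∙y)
    w = σᴬ u
    Xᵍ = _^_ F X g
    linear-part : w ∙ (A ⊗ᴹ Xᵍ ⊗ᴹ B) ≋ σᴮ (u ∙ X)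
    linear-part = begin
      w ∙ (A ⊗ᴹ Xᵍ ⊗ᴹ B)   ≈⟨ ∙-assoc w (A ⊗ᴹ Xᵍ) B ⟨
      w ∙ (A ⊗ᴹ Xᵍ) ∙ B    ≈⟨ ∙-congʳ B (∙-assoc w A Xᵍ) ⟨
      w ∙ A ∙ Xᵍ ∙ B       ≈⟨ ∙-congʳ B (∙-congʳ Xᵍ (∙-cancel A⁻¹ A (proj₂ (proj₂ A-inv)) (γᵥ u))) ⟩
      γᵥ u ∙ Xᵍ ∙ B        ≈⟨ ∙-congʳ B (γᵥ-∙ u X) ⟨
      γᵥ (u ∙ X) ∙ B       ∎

  φ-graph : ∀ {X Y b b′} → Y ≈ᴹ transform X → b′ ≋ σᴮ b →
            ∀ q → OnGraph X b q ⇔ OnGraph Y b′ (Inverse.to φ q)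
  φ-graph {X} {Y} {b} {b′} Y≈tX b′≋σb (u , v) = begin
    v ≋ u ∙ X ⊕ b                                   ∼⟨ to-≈⇔ semilinearᴮ ⟩
    σᴮ v ≋ σᴮ (u ∙ X ⊕ b)                           ∼⟨ ⊕-cancelʳ⇔ (σᴬ u ∙ C) ⟩
    σᴮ v ⊕ σᴬ u ∙ C ≋ σᴮ (u ∙ X ⊕ b) ⊕ σᴬ u ∙ C     ∼⟨ ≋-respʳ⇔ (V.sym row) ⟩
    σᴮ v ⊕ σᴬ u ∙ C ≋ σᴬ u ∙ Y ⊕ b′                 ∎
    where
    open EquationalReasoning {k = equivalence}
    row : σᴬ u ∙ Y ⊕ b′ ≋ σᴮ (u ∙ X ⊕ b) ⊕ σᴬ u ∙ C
    row = V.trans (V.∙-cong (∙-cong V.refl Y≈tX) b′≋σb) (σᴬ-∙-transform X u b)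

  φ-vertical : ∀ {a a′} → a′ ≋ σᴬ a → ∀ q → (proj₁ q ≋ a) ⇔ (proj₁ (Inverse.to φ q) ≋ a′)
  φ-vertical a′≋σa (u , v) =
    ⇔.trans (to-≈⇔ semilinearᴬ) (≋-respʳ⇔ (V.sym a′≋σa))

  module _ {p : Level} {C₁ C₂ : Code F p m n}
           (C₂≡image : ∀ Y → C₂ Y ⇔ (∃ λ X → C₁ X × Y ≈ᴹ transform X)) where

    infix 4 _∈₁_ _∈₂_

    _∈₁_ : Point F m n → TLine F C₁ → Set (c ⊔ ℓ)
    _∈₁_ = _∈_ {C = C₁}

    _∈₂_ : Point F m n → TLine F C₂ → Set (c ⊔ ℓ)
    _∈₂_ = _∈_ {C = C₂}

    preimage : ∀ {Y} → C₂ Y → ∃ λ X → C₁ X × Y ≈ᴹ transform X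
    preimage {Y} = Equivalence.to (C₂≡image Y)

    transform∈C₂ : ∀ {X} → C₁ X → C₂ (transform X)
    transform∈C₂ {X} X∈C₁ = Equivalence.from (C₂≡image (transform X)) (X , X∈C₁ , ≈ᴹ-refl)

    α : TLine F C₁ → TLine F C₂
    α (inj₁ ((X , X∈C₁) , b)) = inj₁ ((transform X , transform∈C₂ X∈C₁) , σᴮ b)
    α (inj₂ a)                = inj₂ (σᴬ a)

    α⁻ : TLine F C₂ → TLine F C₁
    α⁻ (inj₁ ((Y , Y∈C₂) , b′)) = let (X , X∈C₁ , _) = preimage Y∈C₂ in
                                  inj₁ ((X , X∈C₁) , Inverse.from semilinearᴮ b′)
    α⁻ (inj₂ a′)                = inj₂ (Inverse.from semilinearᴬ a′)

    graph-incidence : ∀ {X X∈C₁ b Y Y∈C₂ b′} → Y ≈ᴹ transform X → b′ ≋ σᴮ b → ∀ q →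
      q ∈₁ inj₁ ((X , X∈C₁) , b) ⇔ Inverse.to φ q ∈₂ inj₁ ((Y , Y∈C₂) , b′)
    graph-incidence {X} {X∈C₁} {b} {Y} {Y∈C₂} {b′} Y≈tX b′≋σb q =
      ⇔.trans (∈-graph⇔ {C = C₁} X X∈C₁ b q)
              (⇔.trans (φ-graph Y≈tX b′≋σb q) (⇔.sym (∈-graph⇔ {C = C₂} Y Y∈C₂ b′ _)))

    vertical-incidence : ∀ {a a′} → a′ ≋ σᴬ a → ∀ q →
      q ∈₁ inj₂ a ⇔ Inverse.to φ q ∈₂ inj₂ a′
    vertical-incidence {a} {a′} a′≋σa q =
      ⇔.trans (∈-vertical⇔ {C = C₁} a q)
              (⇔.trans (φ-vertical a′≋σa q) (⇔.sym (∈-vertical⇔ {C = C₂} a′ _)))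

    α-incidence : ∀ q L → q ∈₁ L ⇔ Inverse.to φ q ∈₂ α L
    α-incidence q (inj₁ ((X , X∈C₁) , b)) =
      graph-incidence {X∈C₁ = X∈C₁} {Y∈C₂ = transform∈C₂ X∈C₁} ≈ᴹ-refl V.refl q
    α-incidence q (inj₂ _) = vertical-incidence V.refl q

    α⁻-incidence : ∀ q L → q ∈₁ α⁻ L ⇔ Inverse.to φ q ∈₂ L
    α⁻-incidence q (inj₁ ((Y , Y∈C₂) , b′)) =
      let (X , X∈C₁ , Y≈tX) = preimage Y∈C₂ in
      graph-incidence {X∈C₁ = X∈C₁} {Y∈C₂ = Y∈C₂} Y≈tX
                      (V.sym (Inverse.strictlyInverseˡ semilinearᴮ b′)) q
    α⁻-incidence q (inj₂ a′) = vertical-incidence (V.sym (Inverse.strictlyInverseˡ semilinearᴬ a′)) q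

    translationIso : 𝒯 F C₁ ≅ᴵ 𝒯 F C₂
    translationIso = ≅ᴵ-from-incidence to from to-cong from-cong strictlyInverseʳ strictlyInverseˡ
                       ∈-resp α α⁻ α-incidence α⁻-incidence
      where open Inverse φ

    S-correspondence : ∀ {X Y} → Y ≈ᴹ transform X → ∀ q → S F X q ⇔ S F Y (Inverse.to φ q)
    S-correspondence {X} {Y} Y≈tX q =
      ⇔.trans (S⇔OnGraph X q) (⇔.trans (φ-graph Y≈tX (V.sym (semilinear-0 B)) q) (⇔.sym (S⇔OnGraph Y _)))

    S∞-correspondence : ∀ q → S∞ F q ⇔ S∞ F (Inverse.to φ q)
    S∞-correspondence q =
      ⇔.trans (S∞⇔ q) (⇔.trans (φ-vertical (V.sym (semilinear-0 A⁻¹)) q) (⇔.sym (S∞⇔ _)))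

    kernelIso : KernelIso F C₁ C₂
    kernelIso = kernelIso-by-conjugation F φ φ-+ S∞-correspondence
      (λ X X∈C₁ → transform X , transform∈C₂ X∈C₁ , S-correspondence ≈ᴹ-refl)
      (λ Y Y∈C₂ → let (X , X∈C₁ , Y≈tX) = preimage Y∈C₂ in X , X∈C₁ , S-correspondence Y≈tX)

lemma3p1 : ∀ {c ℓ p : Level} (F : Field c ℓ) {m n : ℕ} (C₁ C₂ : Code F p m n)
    → Equivalent F C₁ C₂
    → (𝒯 F C₁ ≅ᴵ 𝒯 F C₂) × KernelIso F C₁ C₂
lemma3p1 F C₁ C₂ (A , B , C , g , A-inv , B-inv , C₂≡image) =
  translationIso C₂≡image , kernelIso C₂≡image
  where open EquivalentCodes F A B C g A-inv B-inv
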